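{- Let $p,q$ be prime numbers. Then: (i) if $2^p-1\nmid q$, then $M_p\nmid M_{pq}/M_p$; (ii) $M_p\nmid M_{p^3}/M_p$.
   Context: For an integer $n\ge 0$, $M_n=2^n-1$ denotes the $n$-th Mersenne number. -}

module Defs where

open import Data.Nat.Base using (ℕ; zero; suc; _^_; _∸_; _<_; NonZero; >-nonZero; >-nonZero⁻¹; s≤s; z≤n)
open import Data.Nat.Properties using (^-monoʳ-<; m<n⇒0<n∸m)
open import Data.Nat.Primality using (Prime; prime⇒nonZero)

M : ℕ → ℕ
M n = 2 ^ n ∸ 1

M-prime-nonZero : ∀ {p} → Prime p → NonZero (M p)
M-prime-nonZero {p} pp =
  >-nonZero (m<n⇒0<n∸m (^-monoʳ-< 2 (s≤s (s≤s z≤n)) (>-nonZero⁻¹ p {{prime⇒nonZero pp}})))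

{-# OPTIONS --safe #-}
module Submission where

-- Writing x = 2^p = M_p + 1, we have M_{pk} = x^k - 1 = M_p (1 + x + ⋯ + x^(k-1)), so the
-- quotient M_{pk}/M_p is a geometric sum whose k terms are all ≡ 1 (mod M_p).  Hence
-- M_p ∣ M_{pk}/M_p exactly when M_p ∣ k.  Part (i) is the case k = q; part (ii) is the case
-- k = p², where M_p ∤ p² because p² < 2^p - 1 once p ≥ 5, the cases p ≤ 4 being checked directly.

open import Defs
open import Data.Nat.Base using (ℕ; _*_; _^_)
open import Data.Nat.DivMod using (_/_)
open import Data.Nat.Divisibility using (_∣_; _∤_)
open import Data.Nat.Primality using (Prime)
open import Data.Product using (_×_)

open import Data.Nat.Base using (zero; suc; _+_; _∸_; _≤_; _<_; NonZero; s≤s; nonTrivial⇒n>1)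
open import Data.Nat.DivMod using (_%_; m*n/n≡m; [m+kn]%n≡m%n; %-distribˡ-+)
open import Data.Nat.Divisibility using (_∣?_; m%n≡0⇒n∣m; n∣m⇒m%n≡0; ∣⇒≤)
open import Data.Nat.Properties
  using (m^n>0; +-comm; m∸n+n≡m; m+n∸n≡m; ^-*-assoc; *-comm; *-zeroʳ; m≤m+n; *-monoʳ-≤; ∸-monoˡ-≤;
         <-≤-trans; <-irrefl; module ≤-Reasoning)
open import Data.Nat.Primality using (prime⇒nonTrivial)
open import Data.Nat.Solver using (module +-*-Solver)
open import Data.Product using (_,_)
open import Function.Base using (_∘_)
open import Relation.Binary.PropositionalEquality using (_≡_; refl; trans; cong; module ≡-Reasoning)
open import Relation.Nullary.Decidable using (from-no)
open +-*-Solver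

geometricSum : ℕ → ℕ → ℕ
geometricSum x zero    = 0
geometricSum x (suc k) = 1 + x * geometricSum x k

geometricSum-telescope : ∀ m k → m * geometricSum (suc m) k + 1 ≡ suc m ^ k
geometricSum-telescope m zero    = cong (_+ 1) (*-zeroʳ m)
geometricSum-telescope m (suc k) = begin
  m * (1 + suc m * s) + 1  ≡⟨ solve 2 (λ m s → m :* (con 1 :+ (con 1 :+ m) :* s) :+ con 1
                                           := (con 1 :+ m) :* (m :* s :+ con 1)) refl m s ⟩
  suc m * (m * s + 1)      ≡⟨ cong (suc m *_) (geometricSum-telescope m k) ⟩
  suc m * suc m ^ k        ∎
  where open ≡-Reasoning
        s = geometricSum (suc m) k

geometricSum-mod : ∀ m k .{{_ : NonZero m}} → geometricSum (suc m) k % m ≡ k % m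
geometricSum-mod m zero    = refl
geometricSum-mod m (suc k) = begin
  (1 + suc m * s) % m       ≡⟨ cong (_% m) (solve 2 (λ m s → con 1 :+ (con 1 :+ m) :* s
                                                        := (con 1 :+ s) :+ s :* m) refl m s) ⟩
  ((1 + s) + s * m) % m     ≡⟨ [m+kn]%n≡m%n (1 + s) s m ⟩
  (1 + s) % m               ≡⟨ %-distribˡ-+ 1 s m ⟩
  (1 % m + s % m) % m       ≡⟨ cong (λ r → (1 % m + r) % m) (geometricSum-mod m k) ⟩
  (1 % m + k % m) % m       ≡⟨ %-distribˡ-+ 1 k m ⟨
  suc k % m                 ∎
  where open ≡-Reasoning
        s = geometricSum (suc m) k

suc-M : ∀ n → suc (M n) ≡ 2 ^ n
suc-M n = trans (+-comm 1 (M n)) (m∸n+n≡m (m^n>0 2 n))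

M[p*k]≡M[p]*geometricSum : ∀ p k → M (p * k) ≡ M p * geometricSum (suc (M p)) k
M[p*k]≡M[p]*geometricSum p k = begin
  2 ^ (p * k) ∸ 1                               ≡⟨ cong (_∸ 1) (^-*-assoc 2 p k) ⟨
  (2 ^ p) ^ k ∸ 1                               ≡⟨ cong (λ x → x ^ k ∸ 1) (suc-M p) ⟨
  suc (M p) ^ k ∸ 1                             ≡⟨ cong (_∸ 1) (geometricSum-telescope (M p) k) ⟨
  M p * geometricSum (suc (M p)) k + 1 ∸ 1      ≡⟨ m+n∸n≡m _ 1 ⟩
  M p * geometricSum (suc (M p)) k              ∎
  where open ≡-Reasoning

M[p*k]/M[p]≡geometricSum : ∀ p k .{{_ : NonZero (M p)}} → M (p * k) / M p ≡ geometricSum (suc (M p)) k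
M[p*k]/M[p]≡geometricSum p k =
  trans (cong (_/ M p) (trans (M[p*k]≡M[p]*geometricSum p k) (*-comm (M p) _))) (m*n/n≡m _ (M p))

M[p]∣M[p*k]/M[p]⇒M[p]∣k : ∀ p k .{{_ : NonZero (M p)}} → M p ∣ M (p * k) / M p → M p ∣ k
M[p]∣M[p*k]/M[p]⇒M[p]∣k p k ∣quot = m%n≡0⇒n∣m k (M p) (begin
  k % M p                                 ≡⟨ geometricSum-mod (M p) k ⟨
  geometricSum (suc (M p)) k % M p        ≡⟨ cong (_% M p) (M[p*k]/M[p]≡geometricSum p k) ⟨
  M (p * k) / M p % M p                   ≡⟨ n∣m⇒m%n≡0 _ (M p) ∣quot ⟩
  0                                       ∎)
  where open ≡-Reasoning

2+n²≤2^n : ∀ k → let n = 5 + k in 2 + n ^ 2 ≤ 2 ^ n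
2+n²≤2^n zero    = m≤m+n 27 5
2+n²≤2^n (suc k) = begin
  2 + (6 + k) ^ 2                             ≤⟨ m≤m+n _ (16 + 8 * k + k ^ 2) ⟩
  2 + (6 + k) ^ 2 + (16 + 8 * k + k ^ 2)      ≡⟨ solve 1 (λ k → con 2 :+ (con 6 :+ k) :^ 2 :+ (con 16 :+ con 8 :* k :+ k :^ 2)
                                                       := con 2 :* (con 2 :+ (con 5 :+ k) :^ 2)) refl k ⟩
  2 * (2 + (5 + k) ^ 2)                       ≤⟨ *-monoʳ-≤ 2 (2+n²≤2^n k) ⟩
  2 * 2 ^ (5 + k)                             ∎
  where open ≤-Reasoning

M[n]∤n² : ∀ n → 1 < n → M n ∤ n ^ 2
M[n]∤n² 1 (s≤s ())
M[n]∤n² 2 _ = from-no (M 2 ∣? 2 ^ 2)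
M[n]∤n² 3 _ = from-no (M 3 ∣? 3 ^ 2)
M[n]∤n² 4 _ = from-no (M 4 ∣? 4 ^ 2)
M[n]∤n² (suc (suc (suc (suc (suc k))))) _ ∣n² = <-irrefl refl (<-≤-trans n²<M[n] (∣⇒≤ ∣n²))
  where n²<M[n] : (5 + k) ^ 2 < M (5 + k)
        n²<M[n] = ∸-monoˡ-≤ 1 (2+n²≤2^n k)

lemma3 : (p q : ℕ) → (pp : Prime p) → Prime q →
    ((M p ∤ q) → M p ∤ ((M (p * q) / M p) {{M-prime-nonZero pp}}))
    × (M p ∤ ((M (p ^ 3) / M p) {{M-prime-nonZero pp}}))
lemma3 p q pp _ =
    (λ M[p]∤q → M[p]∤q ∘ M[p]∣M[p*k]/M[p]⇒M[p]∣k p q)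
  , M[n]∤n² p (nonTrivial⇒n>1 p) ∘ M[p]∣M[p*k]/M[p]⇒M[p]∣k p (p ^ 2)
  where instance _ = M-prime-nonZero pp
                 _ = prime⇒nonTrivial pp
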